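{- Let $n\ge1$ and let $c$ be a subset of $\mathscr{C}_n$. Then $c$ is $n$-admissible if and only if $c^\ast$ is a highest weight vertex for the $A_1$-crystal, i.e. if and only if every prefix of the reading word of $c^\ast$ contains at least as many letters $1$ as letters $\overline{1}$.
   Context: $\mathscr{C}_n=\{\overline{n}<\cdots<\overline{1}<1<\cdots<n\}$. For $i=1,\dots,n$, $N_i(c)=|\{x\in c: x\le\overline{i}\text{ or }x\ge i\}|$; $c$ is $n$-admissible if $N_i(c)\le n-i+1$ for all $i=1,\dots,n$. Define $c^\ast=(d_1,\dots,d_n)$ where $d_i\subseteq\{1,\overline{1}\}$ with $1\in d_i$ iff $\overline{i}\notin c$, and $\overline{1}\in d_i$ iff $i\in c$ (each $d_i$ ordered $1<\overline{1}$). The reading word of $c^\ast$ is obtained by reading the columns $d_n,d_{n-1},\dots,d_1$ (from right to left), each from top to bottom, i.e. with $1$ before $\overline{1}$. -}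

module Defs where

open import Data.Nat using (ℕ; zero; suc; _+_; _≤_; _∸_)
open import Data.Fin using (Fin; toℕ)
open import Data.Bool using (Bool; true; false; if_then_else_; _∨_; _∧_; T?)
open import Data.List using (List; []; _∷_; map; filter; length; _++_; reverse; concat; take)
open import Data.List using (allFin)
open import Relation.Nullary using (Dec; yes; no)
open import Relation.Nullary.Decidable using (⌊_⌋)
import Data.Nat as ℕ

-- The alphabet 𝒞ₙ = {n̄ < ⋯ < 1̄ < 1 < ⋯ < n}.
-- (bar i) stands for the barred letter  \overline{toℕ i + 1},
-- (unbar i) stands for the letter  toℕ i + 1.
data Letter (n : ℕ) : Set where
  bar   : Fin n → Letter n
  unbar : Fin n → Letter n

_≤ᶜ_ : {n : ℕ} → Letter n → Letter n → Bool
bar i   ≤ᶜ bar j   = ⌊ toℕ j ℕ.≤? toℕ i ⌋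
bar i   ≤ᶜ unbar j = true
unbar i ≤ᶜ bar j   = false
unbar i ≤ᶜ unbar j = ⌊ toℕ i ℕ.≤? toℕ j ⌋

allLetters : (n : ℕ) → List (Letter n)
allLetters n = map bar (allFin n) ++ map unbar (allFin n)

SubsetC : ℕ → Set
SubsetC n = Letter n → Bool

-- Nᵢ(c) = |{x ∈ c : x ≤ ī or x ≥ i}|  (index i : Fin n stands for toℕ i + 1)
N : {n : ℕ} → SubsetC n → Fin n → ℕ
N {n} c i = length (filter (λ x → T? (c x ∧ ((x ≤ᶜ bar i) ∨ (unbar i ≤ᶜ x)))) (allLetters n))

Admissible : {n : ℕ} → SubsetC n → Set
Admissible {n} c = (i : Fin n) → N c i ≤ n ∸ toℕ i

data A1 : Set where
  one    : A1
  oneBar : A1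

-- column dᵢ of c*, read top to bottom (1 before 1̄):
-- 1 ∈ dᵢ iff ī ∉ c, and 1̄ ∈ dᵢ iff i ∈ c
column : {n : ℕ} → SubsetC n → Fin n → List A1
column c i =
  (if c (bar i) then [] else one ∷ [])
  ++ (if c (unbar i) then oneBar ∷ [] else [])

readingWord : {n : ℕ} → SubsetC n → List A1
readingWord {n} c = concat (map (column c) (reverse (allFin n)))

count : A1 → List A1 → ℕ
count a [] = 0
count one    (one ∷ w)    = suc (count one w)
count one    (oneBar ∷ w) = count one w
count oneBar (one ∷ w)    = count oneBar w
count oneBar (oneBar ∷ w) = suc (count oneBar w)

HighestWeight : List A1 → Set
HighestWeight w = (k : ℕ) → count oneBar (take k w) ≤ count one (take k w)

{-# OPTIONS --safe #-}
module Submission where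

-- Induct on n by splitting off the letters ±1.  Nᵢ(c) never counts ±1 when i ≥ 2, so the
-- conditions for i ≥ 2 say exactly that c restricted to ±2,…,±n (renumbered) is admissible,
-- and the reading word of c* is that of the restriction followed by the column d₁.  A column
-- is 1?1̄?, so a prefix ending inside it is balanced once the word before it and the whole
-- word are.  What remains is the condition at i = 1: N₁(c) = |c|, and as c* has a letter 1
-- for every ī ∉ c and a 1̄ for every i ∈ c, #1 + |c| = n + #1̄; so |c| ≤ n iff #1̄ ≤ #1.

open import Defs
open import Level using (0ℓ)
open import Data.Bool using (Bool; true; false; if_then_else_; _∧_; _∨_; T?)
open import Data.Bool.Properties using (∧-identityʳ; ∧-zeroʳ)
open import Data.Fin using (Fin; toℕ)
import Data.Fin as Fin
open import Data.List using (List; []; _∷_; _++_; map; filter; length; take; reverse; concat; allFin; tabulate)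
open import Data.List.Properties
  using (filter-++; length-++; map-++; map-∘; map-tabulate; reverse-map; unfold-reverse; concat-++; ++-identityʳ; take-all; take-take)
open import Data.Nat using (ℕ; zero; suc; _+_; _∸_; _≤_; _⊓_; _≤?_; s≤s; s≤s⁻¹; z≤n)
import Data.Nat.Properties as ℕ
open import Algebra.Properties.CommutativeSemigroup ℕ.+-commutativeSemigroup using (interchange)
open import Data.Product using (_×_; _,_)
open import Data.Product.Function.NonDependent.Propositional using (_×-⇔_)
open import Function using (_∘_; id)
open import Function.Bundles using (_⇔_; mk⇔; Equivalence)
open import Function.Properties.Equivalence using (⇔-setoid)
open import Relation.Binary.PropositionalEquality
open import Relation.Nullary using (does; yes; no)
import Relation.Binary.Reasoning.Setoid as SetoidReasoning
open import Relation.Nullary.Decidable using (⌊_⌋; isYes≗does; does-⇔)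

private variable
  n : ℕ
  A B : Set

iverson : Bool → ℕ
iverson true  = 1
iverson false = 0

countWhere : (A → Bool) → List A → ℕ
countWhere p xs = length (filter (T? ∘ p) xs)

countWhere-∷ : (p : A → Bool) (x : A) (xs : List A) →
  countWhere p (x ∷ xs) ≡ iverson (p x) + countWhere p xs
countWhere-∷ p x xs with p x
... | true  = refl
... | false = refl

countWhere-++ : (p : A → Bool) (xs ys : List A) →
  countWhere p (xs ++ ys) ≡ countWhere p xs + countWhere p ys
countWhere-++ p xs ys =
  trans (cong length (filter-++ (T? ∘ p) xs ys)) (length-++ (filter (T? ∘ p) xs))

countWhere-map : (p : B → Bool) (f : A → B) (xs : List A) →
  countWhere p (map f xs) ≡ countWhere (p ∘ f) xs
countWhere-map p f []       = refl
countWhere-map p f (x ∷ xs) = begin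
  countWhere p (f x ∷ map f xs)               ≡⟨ countWhere-∷ p (f x) (map f xs) ⟩
  iverson (p (f x)) + countWhere p (map f xs) ≡⟨ cong (iverson (p (f x)) +_) (countWhere-map p f xs) ⟩
  iverson (p (f x)) + countWhere (p ∘ f) xs   ≡⟨ countWhere-∷ (p ∘ f) x xs ⟨
  countWhere (p ∘ f) (x ∷ xs)                 ∎
  where open ≡-Reasoning

countWhere-cong : {p q : A → Bool} → (∀ x → p x ≡ q x) → (xs : List A) →
  countWhere p xs ≡ countWhere q xs
countWhere-cong p≗q []       = refl
countWhere-cong {p = p} {q} p≗q (x ∷ xs) = begin
  countWhere p (x ∷ xs)            ≡⟨ countWhere-∷ p x xs ⟩
  iverson (p x) + countWhere p xs  ≡⟨ cong₂ _+_ (cong iverson (p≗q x)) (countWhere-cong p≗q xs) ⟩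
  iverson (q x) + countWhere q xs  ≡⟨ countWhere-∷ q x xs ⟨
  countWhere q (x ∷ xs)            ∎
  where open ≡-Reasoning

countWhere-allFin-suc : (p : Fin (suc n) → Bool) →
  countWhere p (allFin (suc n)) ≡ iverson (p Fin.zero) + countWhere (p ∘ Fin.suc) (allFin n)
countWhere-allFin-suc {n} p = begin
  countWhere p (Fin.zero ∷ tabulate Fin.suc)              ≡⟨ countWhere-∷ p Fin.zero _ ⟩
  iverson (p Fin.zero) + countWhere p (tabulate Fin.suc)
    ≡⟨ cong (λ xs → iverson (p Fin.zero) + countWhere p xs) (map-tabulate id Fin.suc) ⟨
  iverson (p Fin.zero) + countWhere p (map Fin.suc (allFin n))
    ≡⟨ cong (iverson (p Fin.zero) +_) (countWhere-map p Fin.suc (allFin n)) ⟩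
  iverson (p Fin.zero) + countWhere (p ∘ Fin.suc) (allFin n) ∎
  where open ≡-Reasoning

⌊≤?⌋-suc : ∀ m k → ⌊ suc m ≤? suc k ⌋ ≡ ⌊ m ≤? k ⌋
⌊≤?⌋-suc m k = begin
  ⌊ suc m ≤? suc k ⌋    ≡⟨ isYes≗does (suc m ≤? suc k) ⟩
  does (suc m ≤? suc k) ≡⟨ does-⇔ (mk⇔ s≤s⁻¹ s≤s) (suc m ≤? suc k) (m ≤? k) ⟩
  does (m ≤? k)         ≡⟨ isYes≗does (m ≤? k) ⟨
  ⌊ m ≤? k ⌋            ∎
  where open ≡-Reasoning

shiftLetter : Letter n → Letter (suc n)
shiftLetter (bar i)   = bar (Fin.suc i)
shiftLetter (unbar i) = unbar (Fin.suc i)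

≤ᶜ-shiftLetter : (x y : Letter n) → (shiftLetter x ≤ᶜ shiftLetter y) ≡ (x ≤ᶜ y)
≤ᶜ-shiftLetter (bar i)   (bar j)   = ⌊≤?⌋-suc (toℕ j) (toℕ i)
≤ᶜ-shiftLetter (bar i)   (unbar j) = refl
≤ᶜ-shiftLetter (unbar i) (bar j)   = refl
≤ᶜ-shiftLetter (unbar i) (unbar j) = ⌊≤?⌋-suc (toℕ i) (toℕ j)

≤bar₀∨unbar₀≤ : (x : Letter (suc n)) → ((x ≤ᶜ bar Fin.zero) ∨ (unbar Fin.zero ≤ᶜ x)) ≡ true
≤bar₀∨unbar₀≤ (bar i)   = refl
≤bar₀∨unbar₀≤ (unbar i) = refl

tail : SubsetC (suc n) → SubsetC n
tail c = c ∘ shiftLetter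

size : SubsetC n → ℕ
size {n} c = countWhere c (allLetters n)

countWhere-allLetters : (p : Letter n → Bool) →
  countWhere p (allLetters n) ≡ countWhere (p ∘ bar) (allFin n) + countWhere (p ∘ unbar) (allFin n)
countWhere-allLetters {n} p =
  trans (countWhere-++ p (map bar (allFin n)) (map unbar (allFin n)))
        (cong₂ _+_ (countWhere-map p bar (allFin n)) (countWhere-map p unbar (allFin n)))

countWhere-allLetters-suc : (p : Letter (suc n) → Bool) →
  countWhere p (allLetters (suc n)) ≡
  countWhere (p ∘ shiftLetter) (allLetters n) + (iverson (p (bar Fin.zero)) + iverson (p (unbar Fin.zero)))
countWhere-allLetters-suc {n} p = begin
  countWhere p (allLetters (suc n))
    ≡⟨ countWhere-allLetters p ⟩
  countWhere (p ∘ bar) (allFin (suc n)) + countWhere (p ∘ unbar) (allFin (suc n))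
    ≡⟨ cong₂ _+_ (countWhere-allFin-suc (p ∘ bar)) (countWhere-allFin-suc (p ∘ unbar)) ⟩
  (b₀ + bars) + (u₀ + unbars) ≡⟨ interchange b₀ bars u₀ unbars ⟩
  (b₀ + u₀) + (bars + unbars) ≡⟨ ℕ.+-comm (b₀ + u₀) _ ⟩
  (bars + unbars) + (b₀ + u₀) ≡⟨ cong (_+ (b₀ + u₀)) (countWhere-allLetters (p ∘ shiftLetter)) ⟨
  countWhere (p ∘ shiftLetter) (allLetters n) + (b₀ + u₀) ∎
  where
  open ≡-Reasoning
  b₀ = iverson (p (bar Fin.zero))
  u₀ = iverson (p (unbar Fin.zero))
  bars = countWhere (p ∘ bar ∘ Fin.suc) (allFin n)
  unbars = countWhere (p ∘ unbar ∘ Fin.suc) (allFin n)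

N-zero : (c : SubsetC (suc n)) → N c Fin.zero ≡ size c
N-zero {n} c = countWhere-cong
  (λ x → trans (cong (c x ∧_) (≤bar₀∨unbar₀≤ x)) (∧-identityʳ (c x))) (allLetters (suc n))

N-suc : (c : SubsetC (suc n)) (i : Fin n) → N c (Fin.suc i) ≡ N (tail c) i
N-suc {n} c i = begin
  countWhere P (allLetters (suc n))
    ≡⟨ countWhere-allLetters-suc P ⟩
  countWhere (P ∘ shiftLetter) (allLetters n) + (iverson (c (bar Fin.zero) ∧ false) + iverson (c (unbar Fin.zero) ∧ false))
    ≡⟨ cong₂ (λ m k → countWhere (P ∘ shiftLetter) (allLetters n) + (iverson m + iverson k))
             (∧-zeroʳ (c (bar Fin.zero))) (∧-zeroʳ (c (unbar Fin.zero))) ⟩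
  countWhere (P ∘ shiftLetter) (allLetters n) + 0
    ≡⟨ ℕ.+-identityʳ _ ⟩
  countWhere (P ∘ shiftLetter) (allLetters n)
    ≡⟨ countWhere-cong (λ y → cong (tail c y ∧_)
         (cong₂ _∨_ (≤ᶜ-shiftLetter y (bar i)) (≤ᶜ-shiftLetter (unbar i) y))) (allLetters n) ⟩
  N (tail c) i ∎
  where
  open ≡-Reasoning
  P : Letter (suc n) → Bool
  P x = c x ∧ ((x ≤ᶜ bar (Fin.suc i)) ∨ (unbar (Fin.suc i) ≤ᶜ x))

Admissible-suc : (c : SubsetC (suc n)) → Admissible c ⇔ (Admissible (tail c) × size c ≤ suc n)
Admissible-suc {n} c = mk⇔
  (λ adm → (λ i → subst (_≤ n ∸ toℕ i) (N-suc c i) (adm (Fin.suc i))) , subst (_≤ suc n) (N-zero c) (adm Fin.zero))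
  λ where
    (adm , size≤) Fin.zero     → subst (_≤ suc n) (sym (N-zero c)) size≤
    (adm , size≤) (Fin.suc i) → subst (_≤ n ∸ toℕ i) (sym (N-suc c i)) (adm i)

-- column c i is definitionally columnWord (c (bar i)) (c (unbar i)).
columnWord : Bool → Bool → List A1
columnWord b u = (if b then [] else one ∷ []) ++ (if u then oneBar ∷ [] else [])

readingWord-suc : (c : SubsetC (suc n)) →
  readingWord c ≡ readingWord (tail c) ++ columnWord (c (bar Fin.zero)) (c (unbar Fin.zero))
readingWord-suc {n} c = begin
  concat (map (column c) (reverse (Fin.zero ∷ tabulate Fin.suc)))
    ≡⟨ cong (concat ∘ map (column c)) (unfold-reverse Fin.zero (tabulate Fin.suc)) ⟩
  concat (map (column c) (reverse (tabulate Fin.suc) ++ Fin.zero ∷ []))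
    ≡⟨ cong concat (map-++ (column c) (reverse (tabulate Fin.suc)) (Fin.zero ∷ [])) ⟩
  concat (map (column c) (reverse (tabulate Fin.suc)) ++ column c Fin.zero ∷ [])
    ≡⟨ concat-++ (map (column c) (reverse (tabulate Fin.suc))) (column c Fin.zero ∷ []) ⟨
  concat (map (column c) (reverse (tabulate Fin.suc))) ++ (column c Fin.zero ++ [])
    ≡⟨ cong₂ _++_ (cong concat later-columns) (++-identityʳ (column c Fin.zero)) ⟩
  readingWord (tail c) ++ column c Fin.zero ∎
  where
  open ≡-Reasoning
  later-columns : map (column c) (reverse (tabulate Fin.suc)) ≡ map (column (tail c)) (reverse (allFin n))
  later-columns = begin
    map (column c) (reverse (tabulate Fin.suc))
      ≡⟨ cong (map (column c) ∘ reverse) (map-tabulate id Fin.suc) ⟨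
    map (column c) (reverse (map Fin.suc (allFin n)))
      ≡⟨ cong (map (column c)) (reverse-map Fin.suc (allFin n)) ⟨
    map (column c) (map Fin.suc (reverse (allFin n)))
      ≡⟨ map-∘ (reverse (allFin n)) ⟨
    map (column (tail c)) (reverse (allFin n)) ∎

count-++ : ∀ a (xs ys : List A1) → count a (xs ++ ys) ≡ count a xs + count a ys
count-++ a      []            ys = refl
count-++ one    (one ∷ xs)    ys = cong suc (count-++ one xs ys)
count-++ one    (oneBar ∷ xs) ys = count-++ one xs ys
count-++ oneBar (one ∷ xs)    ys = count-++ oneBar xs ys
count-++ oneBar (oneBar ∷ xs) ys = cong suc (count-++ oneBar xs ys)

count-columnWord : ∀ b u →
  count one (columnWord b u) + (iverson b + iverson u) ≡ 1 + count oneBar (columnWord b u)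
count-columnWord true  true  = refl
count-columnWord true  false = refl
count-columnWord false true  = refl
count-columnWord false false = refl

count-readingWord : (n : ℕ) (c : SubsetC n) →
  count one (readingWord c) + size c ≡ n + count oneBar (readingWord c)
count-readingWord zero    c = refl
count-readingWord (suc n) c = begin
  count one (readingWord c) + size c
    ≡⟨ cong₂ _+_ (count-readingWord-suc one) (countWhere-allLetters-suc c) ⟩
  (count one w + count one d) + (size (tail c) + (iverson b + iverson u))
    ≡⟨ interchange (count one w) (count one d) (size (tail c)) _ ⟩
  (count one w + size (tail c)) + (count one d + (iverson b + iverson u))
    ≡⟨ cong₂ _+_ (count-readingWord n (tail c)) (count-columnWord b u) ⟩
  (n + count oneBar w) + (1 + count oneBar d)
    ≡⟨ interchange n (count oneBar w) 1 (count oneBar d) ⟩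
  (n + 1) + (count oneBar w + count oneBar d)
    ≡⟨ cong₂ _+_ (ℕ.+-comm n 1) (sym (count-readingWord-suc oneBar)) ⟩
  suc n + count oneBar (readingWord c) ∎
  where
  open ≡-Reasoning
  b = c (bar Fin.zero)
  u = c (unbar Fin.zero)
  w = readingWord (tail c)
  d = columnWord b u
  count-readingWord-suc : ∀ a → count a (readingWord c) ≡ count a w + count a d
  count-readingWord-suc a = trans (cong (count a) (readingWord-suc c)) (count-++ a w d)

Balanced : List A1 → Set
Balanced w = count oneBar w ≤ count one w

+≡+⇒≤⇔≤ : {a b c d : ℕ} → a + b ≡ c + d → (b ≤ c) ⇔ (d ≤ a)
+≡+⇒≤⇔≤ {a} {b} {c} {d} e = mk⇔
  (λ b≤c → ℕ.+-cancelˡ-≤ c d a (begin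
    c + d ≡⟨ e ⟨
    a + b ≤⟨ ℕ.+-monoʳ-≤ a b≤c ⟩
    a + c ≡⟨ ℕ.+-comm a c ⟩
    c + a ∎))
  (λ d≤a → ℕ.+-cancelˡ-≤ a b c (begin
    a + b ≡⟨ e ⟩
    c + d ≤⟨ ℕ.+-monoʳ-≤ c d≤a ⟩
    c + a ≡⟨ ℕ.+-comm c a ⟩
    a + c ∎))
  where open ℕ.≤-Reasoning

size≤⇔Balanced-readingWord : (c : SubsetC n) → size c ≤ n ⇔ Balanced (readingWord c)
size≤⇔Balanced-readingWord {n} c = +≡+⇒≤⇔≤ (count-readingWord n c)

Balanced-++-one : (w : List A1) → Balanced w → Balanced (w ++ one ∷ [])
Balanced-++-one w bal = begin
  count oneBar (w ++ one ∷ []) ≡⟨ count-++ oneBar w (one ∷ []) ⟩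
  count oneBar w + 0           ≡⟨ ℕ.+-identityʳ _ ⟩
  count oneBar w               ≤⟨ bal ⟩
  count one w                  ≤⟨ ℕ.m≤m+n (count one w) 1 ⟩
  count one w + 1              ≡⟨ count-++ one w (one ∷ []) ⟨
  count one (w ++ one ∷ [])    ∎
  where open ℕ.≤-Reasoning

HighestWeight⇒Balanced : (w : List A1) → HighestWeight w → Balanced w
HighestWeight⇒Balanced w hw = subst Balanced (take-all (length w) w ℕ.≤-refl) (hw (length w))

take-++ : ∀ k (w v : List A) → take k (w ++ v) ≡ take k w ++ take (k ∸ length w) v
take-++ zero    []      v = refl
take-++ (suc k) []      v = refl
take-++ zero    (x ∷ w) v = refl
take-++ (suc k) (x ∷ w) v = cong (x ∷_) (take-++ k w v)

take-length-++ : ∀ (w v : List A) k → take (length w + k) (w ++ v) ≡ w ++ take k v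
take-length-++ []      v k = refl
take-length-++ (x ∷ w) v k = cong (x ∷_) (take-length-++ w v k)

take-prefix-of-++ : ∀ k (w v : List A) → take k w ≡ take (k ⊓ length w) (w ++ v)
take-prefix-of-++ k w v = begin
  take k w                              ≡⟨ cong (take k) (trans (take-length-++ w v 0) (++-identityʳ w)) ⟨
  take k (take (length w + 0) (w ++ v)) ≡⟨ take-take k (length w + 0) (w ++ v) ⟩
  take (k ⊓ (length w + 0)) (w ++ v)    ≡⟨ cong (λ m → take (k ⊓ m) (w ++ v)) (ℕ.+-identityʳ (length w)) ⟩
  take (k ⊓ length w) (w ++ v)          ∎
  where open ≡-Reasoning

HighestWeight-++ : (w v : List A1) →
  HighestWeight (w ++ v) ⇔ (HighestWeight w × (∀ k → Balanced (w ++ take k v)))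
HighestWeight-++ w v = mk⇔
  (λ hw → (λ k → subst Balanced (sym (take-prefix-of-++ k w v)) (hw (k ⊓ length w)))
        , (λ k → subst Balanced (take-length-++ w v k) (hw (length w + k))))
  (λ (hw , bal) k → subst Balanced (sym (take-++ k w v)) (prefix hw bal k))
  where
  prefix : HighestWeight w → (∀ k → Balanced (w ++ take k v)) → ∀ k →
    Balanced (take k w ++ take (k ∸ length w) v)
  prefix hw bal k with k ≤? length w
  ... | yes k≤∣w∣ rewrite ℕ.m≤n⇒m∸n≡0 k≤∣w∣ | ++-identityʳ (take k w) = hw k
  ... | no  k≰∣w∣ rewrite take-all k w (ℕ.≰⇒≥ k≰∣w∣)                 = bal (k ∸ length w)

Balanced-++-take-all : (w v : List A1) → Balanced (w ++ v) → ∀ k → length v ≤ k → Balanced (w ++ take k v)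
Balanced-++-take-all w v bal k ∣v∣≤k = subst (λ v′ → Balanced (w ++ v′)) (sym (take-all k v ∣v∣≤k)) bal

Balanced-++-take-columnWord : (w : List A1) (b u : Bool) → Balanced w → Balanced (w ++ columnWord b u) →
  ∀ k → Balanced (w ++ take k (columnWord b u))
Balanced-++-take-columnWord w b     u     bal bal-d 0             = subst Balanced (sym (++-identityʳ w)) bal
Balanced-++-take-columnWord w true  false bal bal-d (suc k)       = bal-d
Balanced-++-take-columnWord w true  true  bal bal-d (suc k)       = Balanced-++-take-all w _ bal-d (suc k) (s≤s z≤n)
Balanced-++-take-columnWord w false false bal bal-d (suc k)       = Balanced-++-take-all w _ bal-d (suc k) (s≤s z≤n)
Balanced-++-take-columnWord w false true  bal bal-d 1             = Balanced-++-one w bal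
Balanced-++-take-columnWord w false true  bal bal-d (suc (suc k)) = Balanced-++-take-all w _ bal-d (suc (suc k)) (s≤s (s≤s z≤n))

HighestWeight-++-columnWord : (w : List A1) (b u : Bool) →
  HighestWeight (w ++ columnWord b u) ⇔ (HighestWeight w × Balanced (w ++ columnWord b u))
HighestWeight-++-columnWord w b u = mk⇔
  (λ hw → let (hw-w , bal) = Equivalence.to (HighestWeight-++ w d) hw in
    hw-w , subst (λ v → Balanced (w ++ v)) (take-all (length d) d ℕ.≤-refl) (bal (length d)))
  (λ (hw-w , bal-d) → Equivalence.from (HighestWeight-++ w d)
    (hw-w , Balanced-++-take-columnWord w b u (HighestWeight⇒Balanced w hw-w) bal-d))
  where d = columnWord b u

HighestWeight-readingWord-suc : (c : SubsetC (suc n)) →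
  HighestWeight (readingWord c) ⇔ (HighestWeight (readingWord (tail c)) × Balanced (readingWord c))
HighestWeight-readingWord-suc c rewrite readingWord-suc c =
  HighestWeight-++-columnWord (readingWord (tail c)) (c (bar Fin.zero)) (c (unbar Fin.zero))

admissible⇔highestWeight : (n : ℕ) (c : SubsetC n) → Admissible c ⇔ HighestWeight (readingWord c)
admissible⇔highestWeight zero    c = mk⇔ (λ _ → λ { zero → z≤n ; (suc k) → z≤n }) (λ _ ())
admissible⇔highestWeight (suc n) c = begin
  Admissible c                                                       ≈⟨ Admissible-suc c ⟩
  (Admissible (tail c) × size c ≤ suc n)                             ≈⟨ admissible⇔highestWeight n (tail c) ×-⇔ size≤⇔Balanced-readingWord c ⟩
  (HighestWeight (readingWord (tail c)) × Balanced (readingWord c)) ≈⟨ HighestWeight-readingWord-suc c ⟨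
  HighestWeight (readingWord c)                                      ∎
  where open SetoidReasoning (⇔-setoid 0ℓ)

mainTheorem9 : (m : ℕ) → let n = suc m in
    (c : SubsetC n) → Admissible c ⇔ HighestWeight (readingWord c)
mainTheorem9 m = admissible⇔highestWeight (suc m)
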